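{- For every $n\in\mathbb{Z}_{\geq 0}$, \[ \sum_{l=0}^{n}(-1)^{l}C_{n-l}^{(-l-1)} = -G_{n+2}. \]
   Context: For $k\in\mathbb{Z}$ let $\mathrm{Li}_k(z)=\sum_{m\ge1} z^m/m^k$ (a rational function of $z$ for $k\le0$). The poly-Bernoulli numbers $C_n^{(k)}$ are defined by $\frac{\mathrm{Li}_k(1-e^{ -t})}{e^t-1}=\sum_{n\ge0}C_n^{(k)}\frac{t^n}{n!}$. The Genocchi numbers $G_n$ are defined by $\frac{2t}{e^t+1}=\sum_{n\ge0}G_n\frac{t^n}{n!}$. -}

module Defs where

open import Data.Nat as ℕ using (ℕ; zero; suc; _!; _<ᵇ_; _∸_)
open import Data.Nat.Properties using (_!≢0; m^n≢0)
open import Data.Integer as ℤ using (ℤ; +_; -[1+_])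
open import Data.Rational using (ℚ; 0ℚ; 1ℚ; _+_; _*_; _-_; -_; _/_)
open import Data.Bool using (if_then_else_)

-- Formal power series in t with rational coefficients:
-- a series is the function n ↦ (coefficient of t^n).
Series : Set
Series = ℕ → ℚ

sumTo : ℕ → (ℕ → ℚ) → ℚ
sumTo zero    f = 0ℚ
sumTo (suc n) f = sumTo n f + f n

oneS : Series
oneS zero    = 1ℚ
oneS (suc n) = 0ℚ

tS : Series
tS zero          = 0ℚ
tS (suc zero)    = 1ℚ
tS (suc (suc n)) = 0ℚ

_+S_ : Series → Series → Series
(f +S g) n = f n + g n

_-S_ : Series → Series → Series
(f -S g) n = f n - g n

scaleS : ℚ → Series → Series
scaleS c f n = c * f n

_*S_ : Series → Series → Series
(f *S g) n = sumTo (suc n) (λ i → f i * g (n ∸ i))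

powS : Series → ℕ → Series
powS f zero    = oneS
powS f (suc j) = f *S powS f j

expS : Series
expS n = (+ 1 / (n !)) {{n !≢0}}

expNegS : Series
expNegS n = ((ℤ.- (+ 1)) ℤ.^ n / (n !)) {{n !≢0}}

-- Coefficient of z^m in Li_k(z) = Σ_{m≥1} z^m / m^k  (k ∈ ℤ); zero for m = 0.
liCoeff : ℤ → ℕ → ℚ
liCoeff k        zero    = 0ℚ
liCoeff (+ l)    (suc m) = (+ 1 / (suc m ℕ.^ l)) {{m^n≢0 (suc m) l}}
liCoeff -[1+ l ] (suc m) = + (suc m ℕ.^ suc l) / 1

-- Li_k(f(t)) for a series f with zero constant term (formal composition):
-- the coefficient of t^n is Σ_{m ≤ n} liCoeff k m · [t^n] f^m
-- (terms with m > n vanish since f has zero constant term).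
liCompose : ℤ → Series → Series
liCompose k f n = sumTo (suc n) (λ m → liCoeff k m * powS f m n)

-- Solving the triangular system  Σ_{i ≤ n} h_i d_{n-i} = L_n  for h,
-- given r = 1 / d_0 :   h_n = r · (L_n − Σ_{i<n} h_i d_{n-i}).
-- 'prefixSol r d L n i' is h_i for i < n (and 0 otherwise).
prefixSol : ℚ → Series → Series → ℕ → Series
prefixSol r d L zero    i = 0ℚ
prefixSol r d L (suc n) i =
  if i <ᵇ n then prefixSol r d L n i
  else r * (L n - sumTo n (λ j → prefixSol r d L n j * d (n ∸ j)))

-- The series h with h · d = L, where d_0 ≠ 0 and r = 1 / d_0.
divUnit : ℚ → Series → Series → Series
divUnit r d L n = prefixSol r d L (suc n) n

-- L / D when L_0 = D_0 = 0 and D_1 = 1: equals (L/t) / (D/t).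
divByT : Series → Series → Series
divByT L D = divUnit 1ℚ (λ n → D (suc n)) (λ n → L (suc n))

egfCoeff : Series → ℕ → ℚ
egfCoeff f n = (+ (n !) / 1) * f n

polyBernoulliC : ℤ → ℕ → ℚ
polyBernoulliC k = egfCoeff (divByT (liCompose k (oneS -S expNegS)) (expS -S oneS))

genocchi : ℕ → ℚ
genocchi = egfCoeff (divUnit (+ 1 / 2) (expS +S oneS) (scaleS (+ 2 / 1) tS))

-- Write z = 1 − e^{−t}. Since z / (e^t − 1) = e^{−t}, the exponential generating function of
-- C^{(−l−1)} is Σ_i (i+1)^{l+1} e^{−t} zⁱ. Let X_i be the solution of X_i′ + (i+1) X_i = e^{−t} zⁱ
-- with X_i(0) = 0. In terms of exponential coefficients this is x_{m+1} = e_m − (i+1) x_m, which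
-- unfolds to (i+1) x_{n+1} = Σ_l (−1)^l (i+1)^{l+1} e_{n−l}; summing over i, the left-hand side
-- becomes the (n+1)-st coefficient of Σ_i (i+1) X_i = 1 − (Σ_i X_i)′, because Σ_i e^{−t} zⁱ = 1.
-- Finally Σ_i X_i = 2t / (e^t + 1): e^t X_0 = t, X_i + e^t X_{i+1} = z^{i+1} / (i+1) (both sides
-- solve the same first-order linear equation), and Σ_i z^{i+1} / (i+1) = −log(1 − z) = t.

module Submission where

open import Defs
open import Data.Nat as ℕ using (ℕ; zero; suc; _∸_; _≤_; _<_; z≤n; s≤s; _!; _^_)
import Data.Nat.Properties as ℕ
open import Data.Integer as ℤ using (+_; -[1+_])
import Data.Integer.Properties as ℤ
open import Data.Rational using (ℚ; 0ℚ; 1ℚ; _+_; _*_; -_; _-_; _/_; fromℚᵘ; toℚᵘ)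
open import Data.Rational.Properties
import Data.Rational.Unnormalised as ℚᵘ
import Data.Rational.Unnormalised.Properties as ℚᵘ
open import Data.Rational.Solver using (module +-*-Solver)
open import Data.Bool using (true; false; T)
open import Data.Sum using (inj₁; inj₂)
open import Data.Empty using (⊥-elim)
open import Relation.Nullary using (yes; no)
open import Relation.Binary.PropositionalEquality
import Relation.Binary.Reasoning.Setoid as SetoidReasoning

open +-*-Solver

-- Rational arithmetic

/-cong-cross : ∀ a b c d .{{_ : ℕ.NonZero b}} .{{_ : ℕ.NonZero d}} →
               a ℤ.* + d ≡ c ℤ.* + b → a / b ≡ c / d
/-cong-cross a (suc b) c (suc d) eq = fromℚᵘ-cong {ℚᵘ.mkℚᵘ a b} {ℚᵘ.mkℚᵘ c d} (ℚᵘ.*≡* eq)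

/-*-/ : ∀ a b c d .{{_ : ℕ.NonZero b}} .{{_ : ℕ.NonZero d}} →
        (a / b) * (c / d) ≡ ((a ℤ.* c) / (b ℕ.* d)) {{ℕ.m*n≢0 b d}}
/-*-/ a (suc b) c (suc d) = toℚᵘ-injective (ℚᵘ.≃-trans (toℚᵘ-homo-* (a / suc b) (c / suc d))
  (ℚᵘ.≃-trans (ℚᵘ.*-cong (toℚᵘ-fromℚᵘ (ℚᵘ.mkℚᵘ a b)) (toℚᵘ-fromℚᵘ (ℚᵘ.mkℚᵘ c d)))
    (ℚᵘ.≃-sym (toℚᵘ-fromℚᵘ (ℚᵘ.mkℚᵘ (a ℤ.* c) (d ℕ.+ b ℕ.* suc d))))))

/-+-/ : ∀ a b c d .{{_ : ℕ.NonZero b}} .{{_ : ℕ.NonZero d}} →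
        (a / b) + (c / d) ≡ ((a ℤ.* + d ℤ.+ c ℤ.* + b) / (b ℕ.* d)) {{ℕ.m*n≢0 b d}}
/-+-/ a (suc b) c (suc d) = toℚᵘ-injective (ℚᵘ.≃-trans (toℚᵘ-homo-+ (a / suc b) (c / suc d))
  (ℚᵘ.≃-trans (ℚᵘ.+-cong (toℚᵘ-fromℚᵘ (ℚᵘ.mkℚᵘ a b)) (toℚᵘ-fromℚᵘ (ℚᵘ.mkℚᵘ c d)))
    (ℚᵘ.≃-sym (toℚᵘ-fromℚᵘ (ℚᵘ.mkℚᵘ _ (d ℕ.+ b ℕ.* suc d))))))

neg-/ : ∀ a b .{{_ : ℕ.NonZero b}} → - (a / b) ≡ (ℤ.- a) / b
neg-/ a (suc b) = toℚᵘ-injective (ℚᵘ.≃-trans (toℚᵘ-homo‿- (a / suc b))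
  (ℚᵘ.≃-trans (ℚᵘ.-‿cong (toℚᵘ-fromℚᵘ (ℚᵘ.mkℚᵘ a b))) (ℚᵘ.≃-sym (toℚᵘ-fromℚᵘ (ℚᵘ.mkℚᵘ (ℤ.- a) b)))))

[-1]^[1+l]/d : ∀ l d .{{_ : ℕ.NonZero d}} → (ℤ.- (+ 1)) ℤ.^ suc l / d ≡ - ((ℤ.- (+ 1)) ℤ.^ l / d)
[-1]^[1+l]/d l d = trans (cong (_/ d) (ℤ.-1*i≡-i ((ℤ.- (+ 1)) ℤ.^ l))) (sym (neg-/ ((ℤ.- (+ 1)) ℤ.^ l) d))

fromℕ : ℕ → ℚ
fromℕ n = + n / 1

fromℕ-+ : ∀ m n → fromℕ (m ℕ.+ n) ≡ fromℕ m + fromℕ n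
fromℕ-+ m n = trans
  (/-cong-cross (+ (m ℕ.+ n)) 1 (+ m ℤ.* + 1 ℤ.+ + n ℤ.* + 1) 1
    (cong (ℤ._* + 1) (sym (cong₂ ℤ._+_ (ℤ.*-identityʳ (+ m)) (ℤ.*-identityʳ (+ n))))))
  (sym (/-+-/ (+ m) 1 (+ n) 1))

fromℕ-* : ∀ m n → fromℕ (m ℕ.* n) ≡ fromℕ m * fromℕ n
fromℕ-* m n = trans (/-cong-cross (+ (m ℕ.* n)) 1 (+ m ℤ.* + n) 1 (cong (ℤ._* + 1) (ℤ.pos-* m n)))
  (sym (/-*-/ (+ m) 1 (+ n) 1))

[1+n]*/[1+n]! : ∀ a n → fromℕ (suc n) * (a / suc n !) {{suc n ℕ.!≢0}} ≡ (a / n !) {{n ℕ.!≢0}}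
[1+n]*/[1+n]! a n = trans (/-*-/ (+ suc n) 1 a (suc n !) {{_}} {{suc n ℕ.!≢0}})
  (/-cong-cross (+ suc n ℤ.* a) (1 ℕ.* suc n !) a (n !) {{ℕ.m*n≢0 1 (suc n !) {{_}} {{suc n ℕ.!≢0}}}} {{n ℕ.!≢0}}
    (trans (trans (cong (ℤ._* + (n !)) (ℤ.*-comm (+ suc n) a)) (ℤ.*-assoc a (+ suc n) (+ (n !))))
           (cong (a ℤ.*_) (sym (trans (ℤ.pos-* 1 (suc n !))
                                      (trans (ℤ.*-identityˡ (+ (suc n !))) (ℤ.pos-* (suc n) (n !))))))))

1/[1+n]*[1+n]≡1 : ∀ n → (+ 1 / suc n) * fromℕ (suc n) ≡ 1ℚ
1/[1+n]*[1+n]≡1 n = trans (/-*-/ (+ 1) (suc n) (+ suc n) 1)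
  (/-cong-cross (+ 1 ℤ.* + suc n) (suc n ℕ.* 1) (+ 1) 1
    (trans (ℤ.*-identityʳ (+ 1 ℤ.* + suc n)) (cong (λ k → + 1 ℤ.* + k) (sym (ℕ.*-identityʳ (suc n))))))

1/[1+n]*[[1+n]*x]≡x : ∀ n x → (+ 1 / suc n) * (fromℕ (suc n) * x) ≡ x
1/[1+n]*[[1+n]*x]≡x n x = trans (sym (*-assoc (+ 1 / suc n) (fromℕ (suc n)) x))
                                (trans (cong (_* x) (1/[1+n]*[1+n]≡1 n)) (*-identityˡ x))

fromℕ-suc-cancelˡ : ∀ n {a b} → fromℕ (suc n) * a ≡ fromℕ (suc n) * b → a ≡ b
fromℕ-suc-cancelˡ n {a} {b} eq =
  trans (sym (1/[1+n]*[[1+n]*x]≡x n a)) (trans (cong (+ 1 / suc n *_) eq) (1/[1+n]*[[1+n]*x]≡x n b))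

-- Finite sums

sumTo-cong-< : ∀ n {f g : ℕ → ℚ} → (∀ i → i < n → f i ≡ g i) → sumTo n f ≡ sumTo n g
sumTo-cong-< zero    eq = refl
sumTo-cong-< (suc n) eq = cong₂ _+_ (sumTo-cong-< n (λ i i<n → eq i (ℕ.m<n⇒m<1+n i<n))) (eq n ℕ.≤-refl)

sumTo-cong : ∀ n {f g : ℕ → ℚ} → (∀ i → f i ≡ g i) → sumTo n f ≡ sumTo n g
sumTo-cong n eq = sumTo-cong-< n (λ i _ → eq i)

sumTo-+ : ∀ n (f g : ℕ → ℚ) → sumTo n (λ i → f i + g i) ≡ sumTo n f + sumTo n g
sumTo-+ zero    f g = refl
sumTo-+ (suc n) f g = trans (cong (_+ (f n + g n)) (sumTo-+ n f g))
  (solve 4 (λ a b c d → (a :+ b) :+ (c :+ d) := (a :+ c) :+ (b :+ d)) refl (sumTo n f) (sumTo n g) (f n) (g n))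

*-distribˡ-sumTo : ∀ n c (f : ℕ → ℚ) → c * sumTo n f ≡ sumTo n (λ i → c * f i)
*-distribˡ-sumTo zero    c f = *-zeroʳ c
*-distribˡ-sumTo (suc n) c f = trans (*-distribˡ-+ c (sumTo n f) (f n)) (cong (_+ c * f n) (*-distribˡ-sumTo n c f))

neg-distrib-sumTo : ∀ n (f : ℕ → ℚ) → - sumTo n f ≡ sumTo n (λ i → - f i)
neg-distrib-sumTo zero    f = refl
neg-distrib-sumTo (suc n) f = trans (neg-distrib-+ (sumTo n f) (f n)) (cong (_+ - f n) (neg-distrib-sumTo n f))

sumTo-- : ∀ n (f g : ℕ → ℚ) → sumTo n (λ i → f i - g i) ≡ sumTo n f - sumTo n g
sumTo-- n f g = trans (sumTo-+ n f (λ i → - g i)) (cong (_+_ (sumTo n f)) (sym (neg-distrib-sumTo n g)))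

sumTo-zero : ∀ n {f : ℕ → ℚ} → (∀ i → i < n → f i ≡ 0ℚ) → sumTo n f ≡ 0ℚ
sumTo-zero zero    eq = refl
sumTo-zero (suc n) eq =
  trans (cong₂ _+_ (sumTo-zero n (λ i i<n → eq i (ℕ.m<n⇒m<1+n i<n))) (eq n ℕ.≤-refl)) (+-identityˡ 0ℚ)

sumTo-suc-head : ∀ n (f : ℕ → ℚ) → sumTo (suc n) f ≡ f 0 + sumTo n (λ i → f (suc i))
sumTo-suc-head zero    f = trans (+-identityˡ (f 0)) (sym (+-identityʳ (f 0)))
sumTo-suc-head (suc n) f = trans (cong (_+ f (suc n)) (sumTo-suc-head n f)) (+-assoc (f 0) _ _)

sumTo-suc-last-zero : ∀ n {f : ℕ → ℚ} → f n ≡ 0ℚ → sumTo (suc n) f ≡ sumTo n f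
sumTo-suc-last-zero n {f} fn≡0 = trans (cong (_+_ (sumTo n f)) fn≡0) (+-identityʳ (sumTo n f))

sumTo-extend : ∀ m n {f : ℕ → ℚ} → (∀ i → m ≤ i → f i ≡ 0ℚ) → m ≤ n → sumTo n f ≡ sumTo m f
sumTo-extend m zero    eq z≤n = refl
sumTo-extend m (suc n) eq m≤1+n with ℕ.m≤n⇒m<n∨m≡n m≤1+n
... | inj₂ refl      = refl
... | inj₁ (s≤s m≤n) = trans (sumTo-suc-last-zero n (eq n m≤n)) (sumTo-extend m n eq m≤n)

sumTo-swap : ∀ m n (a : ℕ → ℕ → ℚ) →
             sumTo m (λ i → sumTo n (a i)) ≡ sumTo n (λ j → sumTo m (λ i → a i j))
sumTo-swap zero    n a = sym (sumTo-zero n (λ _ _ → refl))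
sumTo-swap (suc m) n a = trans (cong (_+ sumTo n (a m)) (sumTo-swap m n a))
  (sym (sumTo-+ n (λ j → sumTo m (λ i → a i j)) (a m)))

sumTo-telescope : ∀ n (f : ℕ → ℚ) → sumTo n (λ i → f i - f (suc i)) ≡ f 0 - f n
sumTo-telescope zero    f = sym (+-inverseʳ (f 0))
sumTo-telescope (suc n) f = trans (cong (_+ (f n - f (suc n))) (sumTo-telescope n f))
  (solve 3 (λ a b c → (a :- b) :+ (b :- c) := a :- c) refl (f 0) (f n) (f (suc n)))

-- Formal power series

module ≗-Reasoning = SetoidReasoning (ℕ →-setoid ℚ)

∂ : Series → Series
∂ f n = fromℕ (suc n) * f (suc n)

+S-cong : ∀ {f f′ g g′} → f ≗ f′ → g ≗ g′ → f +S g ≗ f′ +S g′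
+S-cong eq eq′ n = cong₂ _+_ (eq n) (eq′ n)

*S-congˡ : ∀ f {g g′} → g ≗ g′ → f *S g ≗ f *S g′
*S-congˡ f eq n = sumTo-cong (suc n) (λ i → cong (f i *_) (eq (n ∸ i)))

*S-congʳ : ∀ {f f′} g → f ≗ f′ → f *S g ≗ f′ *S g
*S-congʳ g eq n = sumTo-cong (suc n) (λ i → cong (_* g (n ∸ i)) (eq i))

∂-cong : ∀ {f g} → f ≗ g → ∂ f ≗ ∂ g
∂-cong eq n = cong (fromℕ (suc n) *_) (eq (suc n))

*S-distribˡ-+S : ∀ f g h → f *S (g +S h) ≗ (f *S g) +S (f *S h)
*S-distribˡ-+S f g h n = trans (sumTo-cong (suc n) (λ i → *-distribˡ-+ (f i) (g (n ∸ i)) (h (n ∸ i))))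
  (sumTo-+ (suc n) _ _)

*S-distribʳ-+S : ∀ f g h → (g +S h) *S f ≗ (g *S f) +S (h *S f)
*S-distribʳ-+S f g h n = trans (sumTo-cong (suc n) (λ i → *-distribʳ-+ (f (n ∸ i)) (g i) (h i)))
  (sumTo-+ (suc n) _ _)

*S-distribˡ--S : ∀ f g h → f *S (g -S h) ≗ (f *S g) -S (f *S h)
*S-distribˡ--S f g h n = trans (sumTo-cong (suc n) (λ i →
    solve 3 (λ a b c → a :* (b :- c) := a :* b :- a :* c) refl (f i) (g (n ∸ i)) (h (n ∸ i))))
  (sumTo-- (suc n) _ _)

*S-distribʳ--S : ∀ f g h → (g -S h) *S f ≗ (g *S f) -S (h *S f)
*S-distribʳ--S f g h n = trans (sumTo-cong (suc n) (λ i →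
    solve 3 (λ a b c → (b :- c) :* a := b :* a :- c :* a) refl (f (n ∸ i)) (g i) (h i)))
  (sumTo-- (suc n) _ _)

*S-scaleʳ : ∀ c f g → f *S scaleS c g ≗ scaleS c (f *S g)
*S-scaleʳ c f g n = trans (sumTo-cong (suc n) (λ i →
    solve 3 (λ a b c → a :* (c :* b) := c :* (a :* b)) refl (f i) (g (n ∸ i)) c))
  (sym (*-distribˡ-sumTo (suc n) c _))

*S-identityˡ : ∀ f → oneS *S f ≗ f
*S-identityˡ f n = trans (sumTo-suc-head n _)
  (trans (cong₂ _+_ (*-identityˡ (f n)) (sumTo-zero n (λ i _ → *-zeroˡ (f (n ∸ suc i)))))
         (+-identityʳ (f n)))

∂-+S : ∀ f g → ∂ (f +S g) ≗ ∂ f +S ∂ g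
∂-+S f g n = *-distribˡ-+ (fromℕ (suc n)) (f (suc n)) (g (suc n))

∂--S : ∀ f g → ∂ (f -S g) ≗ ∂ f -S ∂ g
∂--S f g n = solve 3 (λ k a b → k :* (a :- b) := k :* a :- k :* b) refl (fromℕ (suc n)) (f (suc n)) (g (suc n))

∂-scaleS : ∀ c f → ∂ (scaleS c f) ≗ scaleS c (∂ f)
∂-scaleS c f n = solve 3 (λ k a c → k :* (c :* a) := c :* (k :* a)) refl (fromℕ (suc n)) (f (suc n)) c

∂-oneS : ∀ n → ∂ oneS n ≡ 0ℚ
∂-oneS n = *-zeroʳ (fromℕ (suc n))

∂-tS : ∂ tS ≗ oneS
∂-tS zero    = refl
∂-tS (suc n) = *-zeroʳ (fromℕ (suc (suc n)))

-- The weight n+1 of the coefficient (f g)_{n+1} splits as i + (n+1−i).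
∂-*S : ∀ f g → ∂ (f *S g) ≗ (∂ f *S g) +S (f *S ∂ g)
∂-*S f g n = begin
    fromℕ (suc n) * sumTo (suc (suc n)) term
  ≡⟨ *-distribˡ-sumTo (suc (suc n)) (fromℕ (suc n)) term ⟩
    sumTo (suc (suc n)) (λ i → fromℕ (suc n) * term i)
  ≡⟨ sumTo-cong-< (suc (suc n)) split ⟩
    sumTo (suc (suc n)) (λ i → fromℕ i * term i + fromℕ (suc n ∸ i) * term i)
  ≡⟨ sumTo-+ (suc (suc n)) _ _ ⟩
    sumTo (suc (suc n)) (λ i → fromℕ i * term i) + sumTo (suc (suc n)) (λ i → fromℕ (suc n ∸ i) * term i)
  ≡⟨ cong₂ _+_ left right ⟩
    (∂ f *S g) n + (f *S ∂ g) n
  ∎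
  where
  open ≡-Reasoning
  term : ℕ → ℚ
  term i = f i * g (suc n ∸ i)
  split : ∀ i → i < suc (suc n) → fromℕ (suc n) * term i ≡ fromℕ i * term i + fromℕ (suc n ∸ i) * term i
  split i (s≤s i≤1+n) = trans (cong (λ k → fromℕ k * term i) (sym (ℕ.m+[n∸m]≡n i≤1+n)))
    (trans (cong (_* term i) (fromℕ-+ i (suc n ∸ i))) (*-distribʳ-+ (term i) (fromℕ i) (fromℕ (suc n ∸ i))))
  left : sumTo (suc (suc n)) (λ i → fromℕ i * term i) ≡ (∂ f *S g) n
  left = trans (sumTo-suc-head (suc n) _)
    (trans (cong (_+ sumTo (suc n) (λ i → fromℕ (suc i) * term (suc i))) (*-zeroˡ (term 0)))
    (trans (+-identityˡ _)
           (sumTo-cong (suc n) (λ i → sym (*-assoc (fromℕ (suc i)) (f (suc i)) (g (n ∸ i)))))))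
  right : sumTo (suc (suc n)) (λ i → fromℕ (suc n ∸ i) * term i) ≡ (f *S ∂ g) n
  right = trans (sumTo-suc-last-zero (suc n)
      (trans (cong (λ k → fromℕ k * (f (suc n) * g k)) (ℕ.n∸n≡0 (suc n))) (*-zeroˡ (f (suc n) * g 0))))
    (sumTo-cong-< (suc n) (λ i i<1+n → trans (cong (λ k → fromℕ k * (f i * g k)) (ℕ.+-∸-assoc 1 (ℕ.≤-pred i<1+n)))
      (solve 3 (λ a b c → a :* (b :* c) := b :* (a :* c)) refl (fromℕ (suc (n ∸ i))) (f i) (g (suc (n ∸ i))))))

≗-from-∂ : ∀ {f g} → f 0 ≡ g 0 → ∂ f ≗ ∂ g → f ≗ g
≗-from-∂ eq₀ eq zero    = eq₀
≗-from-∂ eq₀ eq (suc n) = fromℕ-suc-cancelˡ n (eq n)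

∂-linear-unique : ∀ {f g} h a → ∂ f ≗ h -S scaleS a f → ∂ g ≗ h -S scaleS a g → f 0 ≡ g 0 → f ≗ g
∂-linear-unique h a ∂f ∂g eq₀ zero    = eq₀
∂-linear-unique h a ∂f ∂g eq₀ (suc n) = fromℕ-suc-cancelˡ n
  (trans (∂f n) (trans (cong (λ x → h n - a * x) (∂-linear-unique h a ∂f ∂g eq₀ n)) (sym (∂g n))))

-- Commutativity and associativity follow from the product rule by induction on the degree.
*S-comm : ∀ f g → f *S g ≗ g *S f
*S-comm f g zero    = cong (_+_ 0ℚ) (*-comm (f 0) (g 0))
*S-comm f g (suc n) = fromℕ-suc-cancelˡ n (begin
  ∂ (f *S g) n                    ≡⟨ ∂-*S f g n ⟩
  (∂ f *S g) n + (f *S ∂ g) n     ≡⟨ cong₂ _+_ (*S-comm (∂ f) g n) (*S-comm f (∂ g) n) ⟩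
  (g *S ∂ f) n + (∂ g *S f) n     ≡⟨ +-comm ((g *S ∂ f) n) ((∂ g *S f) n) ⟩
  (∂ g *S f) n + (g *S ∂ f) n     ≡⟨ sym (∂-*S g f n) ⟩
  ∂ (g *S f) n                    ∎)
  where open ≡-Reasoning

*S-identityʳ : ∀ f → f *S oneS ≗ f
*S-identityʳ f n = trans (*S-comm f oneS n) (*S-identityˡ f n)

*S-assoc : ∀ f g h → (f *S g) *S h ≗ f *S (g *S h)
*S-assoc f g h zero    = cong (_+_ 0ℚ)
  (trans (cong (_* h 0) (+-identityˡ (f 0 * g 0)))
  (trans (*-assoc (f 0) (g 0) (h 0)) (cong (f 0 *_) (sym (+-identityˡ (g 0 * h 0))))))
*S-assoc f g h (suc n) = fromℕ-suc-cancelˡ n (begin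
    ∂ ((f *S g) *S h) n
  ≡⟨ ∂-*S (f *S g) h n ⟩
    (∂ (f *S g) *S h) n + ((f *S g) *S ∂ h) n
  ≡⟨ cong (_+ ((f *S g) *S ∂ h) n) (trans (*S-congʳ h (∂-*S f g) n) (*S-distribʳ-+S h (∂ f *S g) (f *S ∂ g) n)) ⟩
    (((∂ f *S g) *S h) n + ((f *S ∂ g) *S h) n) + ((f *S g) *S ∂ h) n
  ≡⟨ cong₂ _+_ (cong₂ _+_ (*S-assoc (∂ f) g h n) (*S-assoc f (∂ g) h n)) (*S-assoc f g (∂ h) n) ⟩
    ((∂ f *S (g *S h)) n + (f *S (∂ g *S h)) n) + (f *S (g *S ∂ h)) n
  ≡⟨ +-assoc ((∂ f *S (g *S h)) n) _ _ ⟩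
    (∂ f *S (g *S h)) n + ((f *S (∂ g *S h)) n + (f *S (g *S ∂ h)) n)
  ≡⟨ cong (_+_ ((∂ f *S (g *S h)) n))
       (trans (sym (*S-distribˡ-+S f (∂ g *S h) (g *S ∂ h) n)) (*S-congˡ f (λ m → sym (∂-*S g h m)) n)) ⟩
    (∂ f *S (g *S h)) n + (f *S ∂ (g *S h)) n
  ≡⟨ sym (∂-*S f (g *S h) n) ⟩
    ∂ (f *S (g *S h)) n
  ∎)
  where open ≡-Reasoning

*S-swapˡ : ∀ f g h → f *S (g *S h) ≗ g *S (f *S h)
*S-swapˡ f g h n = begin
  (f *S (g *S h)) n   ≡⟨ sym (*S-assoc f g h n) ⟩
  ((f *S g) *S h) n   ≡⟨ *S-congʳ h (*S-comm f g) n ⟩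
  ((g *S f) *S h) n   ≡⟨ *S-assoc g f h n ⟩
  (g *S (f *S h)) n   ∎
  where open ≡-Reasoning

∂-powS : ∀ f i → ∂ (powS f (suc i)) ≗ scaleS (fromℕ (suc i)) (∂ f *S powS f i)
∂-powS f zero n = trans (∂-cong (*S-identityʳ f) n) (sym (trans (*-identityˡ _) (*S-identityʳ (∂ f) n)))
∂-powS f (suc i) = begin
    ∂ (f *S fⁱ⁺¹)
  ≈⟨ ∂-*S f fⁱ⁺¹ ⟩
    (∂ f *S fⁱ⁺¹) +S (f *S ∂ fⁱ⁺¹)
  ≈⟨ +S-cong {∂ f *S fⁱ⁺¹} (λ _ → refl) (*S-congˡ f (∂-powS f i)) ⟩
    (∂ f *S fⁱ⁺¹) +S (f *S scaleS k (∂ f *S powS f i))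
  ≈⟨ +S-cong {∂ f *S fⁱ⁺¹} (λ _ → refl)
       (λ n → trans (*S-scaleʳ k f (∂ f *S powS f i) n) (cong (k *_) (*S-swapˡ f (∂ f) (powS f i) n))) ⟩
    (∂ f *S fⁱ⁺¹) +S scaleS k (∂ f *S fⁱ⁺¹)
  ≈⟨ (λ n → trans (solve 2 (λ k x → x :+ k :* x := (con 1ℚ :+ k) :* x) refl k ((∂ f *S fⁱ⁺¹) n))
                 (cong (_* (∂ f *S fⁱ⁺¹) n) (sym (fromℕ-+ 1 (suc i))))) ⟩
    scaleS (fromℕ (suc (suc i))) (∂ f *S fⁱ⁺¹)
  ∎
  where
  open ≗-Reasoning
  fⁱ⁺¹ : Series
  fⁱ⁺¹ = powS f (suc i)
  k : ℚ
  k = fromℕ (suc i)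

VanishesBelow : Series → ℕ → Set
VanishesBelow f a = ∀ n → n < a → f n ≡ 0ℚ

scaleS-vanishesBelow : ∀ c {f a} → VanishesBelow f a → VanishesBelow (scaleS c f) a
scaleS-vanishesBelow c f<a n n<a = trans (cong (c *_) (f<a n n<a)) (*-zeroʳ c)

*S-vanishesBelow : ∀ {f g a b} → VanishesBelow f a → VanishesBelow g b → VanishesBelow (f *S g) (a ℕ.+ b)
*S-vanishesBelow {f} {g} {a} {b} f<a g<b n n<a+b = sumTo-zero (suc n) term
  where
  term : ∀ i → i < suc n → f i * g (n ∸ i) ≡ 0ℚ
  term i (s≤s i≤n) with i ℕ.<? a
  ... | yes i<a = trans (cong (_* g (n ∸ i)) (f<a i i<a)) (*-zeroˡ (g (n ∸ i)))
  ... | no  i≮a = trans (cong (f i *_) (g<b (n ∸ i) n∸i<b)) (*-zeroʳ (f i))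
    where
    n∸i<b : n ∸ i < b
    n∸i<b = ℕ.+-cancelˡ-< i (n ∸ i) b (begin-strict
      i ℕ.+ (n ∸ i) ≡⟨ ℕ.m+[n∸m]≡n i≤n ⟩
      n             <⟨ n<a+b ⟩
      a ℕ.+ b       ≤⟨ ℕ.+-monoˡ-≤ b (ℕ.≮⇒≥ i≮a) ⟩
      i ℕ.+ b       ∎)
      where open ℕ.≤-Reasoning

powS-vanishesBelow : ∀ {f} → VanishesBelow f 1 → ∀ m → VanishesBelow (powS f m) m
powS-vanishesBelow f<1 zero    n ()
powS-vanishesBelow f<1 (suc m) = *S-vanishesBelow f<1 (powS-vanishesBelow f<1 m)

-- Σ_i F i, summed degreewise; it is the full sum whenever each F i vanishes below t^i.
sumFam : (ℕ → Series) → Series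
sumFam F n = sumTo (suc n) (λ i → F i n)

sumFam-extend : ∀ {F} → (∀ i → VanishesBelow (F i) i) → ∀ {n N} → n < N → sumFam F n ≡ sumTo N (λ i → F i n)
sumFam-extend F<i {n} n<N = sym (sumTo-extend (suc n) _ (λ i n<i → F<i i n n<i) n<N)

*S-sumFam : ∀ g {F} → (∀ i → VanishesBelow (F i) i) → g *S sumFam F ≗ sumFam (λ i → g *S F i)
*S-sumFam g {F} F<i n = begin
    sumTo (suc n) (λ a → g a * sumFam F (n ∸ a))
  ≡⟨ sumTo-cong (suc n) (λ a → cong (g a *_) (sumFam-extend F<i (s≤s (ℕ.m∸n≤m n a)))) ⟩
    sumTo (suc n) (λ a → g a * sumTo (suc n) (λ i → F i (n ∸ a)))
  ≡⟨ sumTo-cong (suc n) (λ a → *-distribˡ-sumTo (suc n) (g a) (λ i → F i (n ∸ a))) ⟩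
    sumTo (suc n) (λ a → sumTo (suc n) (λ i → g a * F i (n ∸ a)))
  ≡⟨ sumTo-swap (suc n) (suc n) (λ a i → g a * F i (n ∸ a)) ⟩
    sumFam (λ i → g *S F i) n
  ∎
  where open ≡-Reasoning

∂-sumFam : ∀ F n → ∂ (sumFam F) n ≡ sumTo (suc (suc n)) (λ i → ∂ (F i) n)
∂-sumFam F n = *-distribˡ-sumTo (suc (suc n)) (fromℕ (suc n)) (λ i → F i (suc n))

egfCoeff-scaleS : ∀ c f n → egfCoeff (scaleS c f) n ≡ c * egfCoeff f n
egfCoeff-scaleS c f n = solve 3 (λ a c x → a :* (c :* x) := c :* (a :* x)) refl (fromℕ (n !)) c (f n)

egfCoeff-suc : ∀ f n → egfCoeff f (suc n) ≡ egfCoeff (∂ f) n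
egfCoeff-suc f n = trans (cong (_* f (suc n)) (fromℕ-* (suc n) (n !)))
  (solve 3 (λ a b x → (a :* b) :* x := b :* (a :* x)) refl (fromℕ (suc n)) (fromℕ (n !)) (f (suc n)))

egfCoeff-linearODE : ∀ {f g} a → ∂ f ≗ g -S scaleS a f →
                     ∀ m → egfCoeff f (suc m) ≡ egfCoeff g m - a * egfCoeff f m
egfCoeff-linearODE {f} {g} a ∂f m = trans (egfCoeff-suc f m)
  (trans (cong (fromℕ (m !) *_) (∂f m))
    (solve 4 (λ k y a x → k :* (y :- a :* x) := k :* y :- a :* (k :* x)) refl (fromℕ (m !)) (g m) a (f m)))

egfCoeff-sumFam : ∀ {F} → (∀ i → VanishesBelow (F i) i) → ∀ {n N} → n < N →
                  egfCoeff (sumFam F) n ≡ sumTo N (λ i → egfCoeff (F i) n)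
egfCoeff-sumFam {F} F<i {n} {N} n<N =
  trans (cong (fromℕ (n !) *_) (sumFam-extend F<i n<N)) (*-distribˡ-sumTo N (fromℕ (n !)) (λ i → F i n))

prefixSol-unique : ∀ {r d L} h → r * d 0 ≡ 1ℚ → h *S d ≗ L → ∀ n i → i < n → prefixSol r d L n i ≡ h i
prefixSol-unique {r} {d} {L} h rd≡1 hd≗L (suc m) i i<1+m with i ℕ.<ᵇ m in i<ᵇm
... | true  = prefixSol-unique h rd≡1 hd≗L m i (ℕ.<ᵇ⇒< i m (subst T (sym i<ᵇm) _))
... | false with ℕ.m≤n⇒m<n∨m≡n i<1+m
...   | inj₁ (s≤s i<m) = ⊥-elim (subst T i<ᵇm (ℕ.<⇒<ᵇ i<m))
...   | inj₂ refl = begin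
    r * (L m - sumTo m (λ j → prefixSol r d L m j * d (m ∸ j)))
  ≡⟨ cong (λ x → r * (L m - x)) (sumTo-cong-< m (λ j j<m → cong (_* d (m ∸ j)) (prefixSol-unique h rd≡1 hd≗L m j j<m))) ⟩
    r * (L m - s)
  ≡⟨ cong (λ x → r * (x - s)) (sym (hd≗L m)) ⟩
    r * ((s + h m * d (m ∸ m)) - s)
  ≡⟨ cong (λ k → r * ((s + h m * d k) - s)) (ℕ.n∸n≡0 m) ⟩
    r * ((s + h m * d 0) - s)
  ≡⟨ solve 4 (λ r s x y → r :* ((s :+ x :* y) :- s) := x :* (r :* y)) refl r s (h m) (d 0) ⟩
    h m * (r * d 0)
  ≡⟨ trans (cong (h m *_) rd≡1) (*-identityʳ (h m)) ⟩
    h m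
  ∎
  where
  open ≡-Reasoning
  s : ℚ
  s = sumTo m (λ j → h j * d (m ∸ j))

divUnit-unique : ∀ {r d L} h → r * d 0 ≡ 1ℚ → h *S d ≗ L → divUnit r d L ≗ h
divUnit-unique h rd≡1 hd≗L n = prefixSol-unique h rd≡1 hd≗L (suc n) n ℕ.≤-refl

*S-shiftʳ : ∀ h {D} → D 0 ≡ 0ℚ → ∀ n → (h *S D) (suc n) ≡ (h *S (λ k → D (suc k))) n
*S-shiftʳ h {D} D₀≡0 n = trans
  (sumTo-suc-last-zero (suc n) (trans (cong (λ k → h (suc n) * D k) (ℕ.n∸n≡0 (suc n)))
                                 (trans (cong (h (suc n) *_) D₀≡0) (*-zeroʳ (h (suc n))))))
  (sumTo-cong-< (suc n) (λ i i<1+n → cong (λ k → h i * D k) (ℕ.+-∸-assoc 1 (ℕ.≤-pred i<1+n))))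

divByT-unique : ∀ {L D} h → D 0 ≡ 0ℚ → D 1 ≡ 1ℚ → h *S D ≗ L → divByT L D ≗ h
divByT-unique {D = D} h D₀≡0 D₁≡1 hD≗L =
  divUnit-unique h (trans (*-identityˡ (D 1)) D₁≡1) (λ n → trans (sym (*S-shiftʳ h {D} D₀≡0 n)) (hD≗L (suc n)))

-- The exponential series and z = 1 − e^{−t}

∂-expS : ∂ expS ≗ expS
∂-expS n = [1+n]*/[1+n]! (+ 1) n

∂-expNegS : ∀ n → ∂ expNegS n ≡ - expNegS n
∂-expNegS n = trans ([1+n]*/[1+n]! ((ℤ.- (+ 1)) ℤ.^ suc n) n) ([-1]^[1+l]/d n (n !) {{n ℕ.!≢0}})

expS*expNegS : expS *S expNegS ≗ oneS
expS*expNegS = ≗-from-∂ refl (λ n → begin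
  ∂ (expS *S expNegS) n                               ≡⟨ ∂-*S expS expNegS n ⟩
  (∂ expS *S expNegS) n + (expS *S ∂ expNegS) n       ≡⟨ cong₂ _+_ (*S-congʳ expNegS ∂-expS n) (*S-congˡ expS ∂-expNegS n) ⟩
  (expS *S expNegS) n + (expS *S (λ k → - expNegS k)) n
    ≡⟨ cong (_+_ ((expS *S expNegS) n)) (trans (sumTo-cong (suc n) (λ i → sym (neg-distribʳ-* (expS i) (expNegS (n ∸ i)))))
                                               (sym (neg-distrib-sumTo (suc n) _))) ⟩
  (expS *S expNegS) n - (expS *S expNegS) n           ≡⟨ +-inverseʳ ((expS *S expNegS) n) ⟩
  0ℚ                                                  ≡⟨ sym (∂-oneS n) ⟩
  ∂ oneS n                                            ∎)
  where open ≡-Reasoning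

zS : Series
zS = oneS -S expNegS

uS : Series
uS = expS -S oneS

zPow : ℕ → Series
zPow = powS zS

E : ℕ → Series
E i = expNegS *S zPow i

zPow-vanishesBelow : ∀ i → VanishesBelow (zPow i) i
zPow-vanishesBelow = powS-vanishesBelow z<1
  where
  z<1 : VanishesBelow zS 1
  z<1 zero    _         = refl
  z<1 (suc n) (s≤s ())

E-vanishesBelow : ∀ i → VanishesBelow (E i) i
E-vanishesBelow i = *S-vanishesBelow {expNegS} {zPow i} {0} (λ _ ()) (zPow-vanishesBelow i)

∂-zS : ∂ zS ≗ expNegS
∂-zS n = trans (∂--S oneS expNegS n)
  (trans (cong₂ _-_ (∂-oneS n) (∂-expNegS n)) (solve 1 (λ x → con 0ℚ :- (:- x) := x) refl (expNegS n)))

∂-zPow : ∀ i → ∂ (zPow (suc i)) ≗ scaleS (fromℕ (suc i)) (E i)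
∂-zPow i n = trans (∂-powS zS i n) (cong (fromℕ (suc i) *_) (*S-congʳ (zPow i) ∂-zS n))

expS*E : ∀ i → expS *S E i ≗ zPow i
expS*E i = begin
  expS *S (expNegS *S zPow i)  ≈⟨ (λ n → sym (*S-assoc expS expNegS (zPow i) n)) ⟩
  (expS *S expNegS) *S zPow i  ≈⟨ *S-congʳ (zPow i) expS*expNegS ⟩
  oneS *S zPow i               ≈⟨ *S-identityˡ (zPow i) ⟩
  zPow i                       ∎
  where open ≗-Reasoning

E*uS : ∀ i → E i *S uS ≗ zPow (suc i)
E*uS i = begin
  (expNegS *S zPow i) *S uS    ≈⟨ *S-congʳ uS (*S-comm expNegS (zPow i)) ⟩
  (zPow i *S expNegS) *S uS    ≈⟨ *S-assoc (zPow i) expNegS uS ⟩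
  zPow i *S (expNegS *S uS)    ≈⟨ *S-congˡ (zPow i) expNegS*uS ⟩
  zPow i *S zS                 ≈⟨ *S-comm (zPow i) zS ⟩
  zPow (suc i)                 ∎
  where
  open ≗-Reasoning
  expNegS*uS : expNegS *S uS ≗ zS
  expNegS*uS n = trans (*S-distribˡ--S expNegS expS oneS n)
    (cong₂ _-_ (trans (*S-comm expNegS expS n) (expS*expNegS n)) (*S-identityʳ expNegS n))

E≗zPow-zPow : ∀ i → E i ≗ zPow i -S zPow (suc i)
E≗zPow-zPow i = begin
  expNegS *S zPow i                    ≈⟨ *S-congʳ (zPow i) (λ n → solve 2 (λ a b → b := a :- (a :- b)) refl (oneS n) (expNegS n)) ⟩
  (oneS -S zS) *S zPow i               ≈⟨ *S-distribʳ--S (zPow i) oneS zS ⟩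
  (oneS *S zPow i) -S (zS *S zPow i)   ≈⟨ (λ n → cong (_- (zS *S zPow i) n) (*S-identityˡ (zPow i) n)) ⟩
  zPow i -S zPow (suc i)               ∎
  where open ≗-Reasoning

-- Telescopes, as e^{−t} zⁱ = (1 − z) zⁱ.
sumFam-E : sumFam E ≗ oneS
sumFam-E n = begin
  sumTo (suc n) (λ i → E i n)                          ≡⟨ sumTo-cong (suc n) (λ i → E≗zPow-zPow i n) ⟩
  sumTo (suc n) (λ i → zPow i n - zPow (suc i) n)      ≡⟨ sumTo-telescope (suc n) (λ i → zPow i n) ⟩
  oneS n - zPow (suc n) n                              ≡⟨ cong (_-_ (oneS n)) (zPow-vanishesBelow (suc n) n ℕ.≤-refl) ⟩
  oneS n - 0ℚ                                          ≡⟨ +-identityʳ (oneS n) ⟩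
  oneS n                                               ∎
  where open ≡-Reasoning

-- Poly-Bernoulli numbers of negative index

polyBernoulliGF : ℕ → Series
polyBernoulliGF l = sumFam (λ i → scaleS (fromℕ (suc i ^ suc l)) (E i))

-- z^{i+1} / (e^t − 1) = e^{−t} zⁱ, so dividing Li_{−l−1}(z) = Σ_i (i+1)^{l+1} z^{i+1} by e^t − 1 is termwise.
polyBernoulliGF*uS : ∀ l → polyBernoulliGF l *S uS ≗ liCompose -[1+ l ] zS
polyBernoulliGF*uS l n = begin
    (polyBernoulliGF l *S uS) n
  ≡⟨ *S-comm (polyBernoulliGF l) uS n ⟩
    (uS *S polyBernoulliGF l) n
  ≡⟨ *S-sumFam uS (λ i → scaleS-vanishesBelow (w i) (E-vanishesBelow i)) n ⟩
    sumTo (suc n) (λ i → (uS *S scaleS (w i) (E i)) n)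
  ≡⟨ sumTo-cong (suc n) (λ i → trans (*S-scaleʳ (w i) uS (E i) n)
                                      (cong (w i *_) (trans (*S-comm uS (E i) n) (E*uS i n)))) ⟩
    sumTo (suc n) (λ i → w i * zPow (suc i) n)
  ≡⟨ sumTo-suc-last-zero n (scaleS-vanishesBelow (w n) (zPow-vanishesBelow (suc n)) n ℕ.≤-refl) ⟩
    sumTo n (λ i → w i * zPow (suc i) n)
  ≡⟨ sym (trans (sumTo-suc-head n _) (trans (cong (_+ sumTo n (λ i → w i * zPow (suc i) n)) (*-zeroˡ (zPow 0 n)))
                                             (+-identityˡ _))) ⟩
    liCompose -[1+ l ] zS n
  ∎
  where
  open ≡-Reasoning
  w : ℕ → ℚ
  w i = fromℕ (suc i ^ suc l)

polyBernoulliC-neg : ∀ l → polyBernoulliC -[1+ l ] ≗ egfCoeff (polyBernoulliGF l)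
polyBernoulliC-neg l m =
  cong (fromℕ (m !) *_) (divByT-unique {D = uS} (polyBernoulliGF l) refl refl (polyBernoulliGF*uS l) m)

polyBernoulliC-neg-expand : ∀ l {m N} → m < N →
  polyBernoulliC -[1+ l ] m ≡ sumTo N (λ i → fromℕ (suc i ^ suc l) * egfCoeff (E i) m)
polyBernoulliC-neg-expand l {m} {N} m<N = trans (polyBernoulliC-neg l m)
  (trans (egfCoeff-sumFam (λ i → scaleS-vanishesBelow (fromℕ (suc i ^ suc l)) (E-vanishesBelow i)) m<N)
         (sumTo-cong N (λ i → egfCoeff-scaleS (fromℕ (suc i ^ suc l)) (E i) m)))

-- Genocchi numbers

-- X i solves X′ + (i+1) X = e^{−t} zⁱ with X(0) = 0.
X : ℕ → Series
X i zero    = 0ℚ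
X i (suc n) = (+ 1 / suc n) * (E i n - fromℕ (suc i) * X i n)

∂-X : ∀ i → ∂ (X i) ≗ E i -S scaleS (fromℕ (suc i)) (X i)
∂-X i n = trans (solve 3 (λ k c y → k :* (c :* y) := c :* (k :* y)) refl (fromℕ (suc n)) (+ 1 / suc n) y)
                (1/[1+n]*[[1+n]*x]≡x n y)
  where
  y : ℚ
  y = E i n - fromℕ (suc i) * X i n

X-vanishesBelow : ∀ i → VanishesBelow (X i) (suc i)
X-vanishesBelow i zero    _             = refl
X-vanishesBelow i (suc n) (s≤s 1+n≤i) = trans
  (cong (λ x → (+ 1 / suc n) * x)
        (cong₂ _-_ (E-vanishesBelow i n 1+n≤i)
                   (trans (cong (fromℕ (suc i) *_) (X-vanishesBelow i n (ℕ.m<n⇒m<1+n 1+n≤i))) (*-zeroʳ (fromℕ (suc i))))))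
  (*-zeroʳ (+ 1 / suc n))

X-vanishesBelow′ : ∀ i → VanishesBelow (X i) i
X-vanishesBelow′ i n n<i = X-vanishesBelow i n (ℕ.m<n⇒m<1+n n<i)

∂-expS*X : ∀ j → ∂ (expS *S X j) ≗ zPow j -S scaleS (fromℕ j) (expS *S X j)
∂-expS*X j n = begin
    ∂ (expS *S X j) n
  ≡⟨ ∂-*S expS (X j) n ⟩
    (∂ expS *S X j) n + (expS *S ∂ (X j)) n
  ≡⟨ cong₂ _+_ (*S-congʳ (X j) ∂-expS n)
               (trans (*S-congˡ expS (∂-X j) n) (*S-distribˡ--S expS (E j) (scaleS (fromℕ (suc j)) (X j)) n)) ⟩
    (expS *S X j) n + ((expS *S E j) n - (expS *S scaleS (fromℕ (suc j)) (X j)) n)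
  ≡⟨ cong (λ x → (expS *S X j) n + x) (cong₂ _-_ (expS*E j n) (*S-scaleʳ (fromℕ (suc j)) expS (X j) n)) ⟩
    (expS *S X j) n + (zPow j n - fromℕ (suc j) * (expS *S X j) n)
  ≡⟨ cong (λ k → (expS *S X j) n + (zPow j n - k * (expS *S X j) n)) (fromℕ-+ 1 j) ⟩
    (expS *S X j) n + (zPow j n - (1ℚ + fromℕ j) * (expS *S X j) n)
  ≡⟨ solve 3 (λ y p k → y :+ (p :- (con 1ℚ :+ k) :* y) := p :- k :* y) refl ((expS *S X j) n) (zPow j n) (fromℕ j) ⟩
    zPow j n - fromℕ j * (expS *S X j) n
  ∎
  where open ≡-Reasoning

expS*X₀ : expS *S X 0 ≗ tS
expS*X₀ = ≗-from-∂ refl (λ n → trans (∂-expS*X 0 n)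
  (trans (solve 2 (λ p y → p :- con 0ℚ :* y := p) refl (oneS n) ((expS *S X 0) n)) (sym (∂-tS n))))

-- Both sides solve F′ + (i+1) F = e^{−t} zⁱ + z^{i+1} with F(0) = 0.
X+expS*X : ∀ i → X i +S (expS *S X (suc i)) ≗ scaleS (+ 1 / suc i) (zPow (suc i))
X+expS*X i = ∂-linear-unique (E i +S zPow (suc i)) k ∂lhs ∂rhs lhs₀
  where
  k c : ℚ
  k = fromℕ (suc i)
  c = + 1 / suc i
  ∂lhs : ∂ (X i +S (expS *S X (suc i))) ≗ (E i +S zPow (suc i)) -S scaleS k (X i +S (expS *S X (suc i)))
  ∂lhs n = trans (∂-+S (X i) (expS *S X (suc i)) n)
    (trans (cong₂ _+_ (∂-X i n) (∂-expS*X (suc i) n))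
      (solve 5 (λ e x p y k → (e :- k :* x) :+ (p :- k :* y) := (e :+ p) :- k :* (x :+ y)) refl
             (E i n) (X i n) (zPow (suc i) n) ((expS *S X (suc i)) n) k))
  ∂rhs : ∂ (scaleS c (zPow (suc i))) ≗ (E i +S zPow (suc i)) -S scaleS k (scaleS c (zPow (suc i)))
  ∂rhs n = begin
    ∂ (scaleS c (zPow (suc i))) n  ≡⟨ ∂-scaleS c (zPow (suc i)) n ⟩
    c * ∂ (zPow (suc i)) n         ≡⟨ cong (c *_) (∂-zPow i n) ⟩
    c * (k * E i n)                ≡⟨ 1/[1+n]*[[1+n]*x]≡x i (E i n) ⟩
    E i n                          ≡⟨ solve 2 (λ e p → e := (e :+ p) :- con 1ℚ :* p) refl (E i n) p ⟩
    (E i n + p) - 1ℚ * p           ≡⟨ cong (λ x → (E i n + p) - x * p) (sym (trans (*-comm k c) (1/[1+n]*[1+n]≡1 i))) ⟩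
    (E i n + p) - (k * c) * p      ≡⟨ cong (_-_ (E i n + p)) (*-assoc k c p) ⟩
    (E i n + p) - k * (c * p)      ∎
    where
    open ≡-Reasoning
    p : ℚ
    p = zPow (suc i) n
  lhs₀ : X i 0 + (expS *S X (suc i)) 0 ≡ c * zPow (suc i) 0
  lhs₀ = sym (trans (cong (c *_) (zPow-vanishesBelow (suc i) 0 (s≤s z≤n))) (*-zeroʳ c))

-- Σ_i z^{i+1} / (i+1) = −log(1 − z) = t.
sumFam-zPow/ : sumFam (λ i → scaleS (+ 1 / suc i) (zPow (suc i))) ≗ tS
sumFam-zPow/ = ≗-from-∂ refl (λ n → begin
    ∂ (sumFam F) n                      ≡⟨ ∂-sumFam F n ⟩
    sumTo (suc (suc n)) (λ i → ∂ (F i) n) ≡⟨ sumTo-cong (suc (suc n)) (λ i → ∂F i n) ⟩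
    sumTo (suc (suc n)) (λ i → E i n)     ≡⟨ sumTo-suc-last-zero (suc n) (E-vanishesBelow (suc n) n ℕ.≤-refl) ⟩
    sumFam E n                          ≡⟨ sumFam-E n ⟩
    oneS n                              ≡⟨ sym (∂-tS n) ⟩
    ∂ tS n                              ∎)
  where
  open ≡-Reasoning
  F : ℕ → Series
  F i = scaleS (+ 1 / suc i) (zPow (suc i))
  ∂F : ∀ i → ∂ (F i) ≗ E i
  ∂F i n = trans (∂-scaleS (+ 1 / suc i) (zPow (suc i)) n)
    (trans (cong (+ 1 / suc i *_) (∂-zPow i n)) (1/[1+n]*[[1+n]*x]≡x i (E i n)))

sumX : Series
sumX = sumFam X

-- The pairs X i + e^t X (i+1) sum to t, leaving e^t X 0 = t.
sumX*[expS+oneS] : sumX *S (expS +S oneS) ≗ scaleS (+ 2 / 1) tS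
sumX*[expS+oneS] n = begin
    (sumX *S (expS +S oneS)) n
  ≡⟨ *S-distribˡ-+S sumX expS oneS n ⟩
    (sumX *S expS) n + (sumX *S oneS) n
  ≡⟨ cong₂ _+_ (trans (*S-comm sumX expS n) (*S-sumFam expS X-vanishesBelow′ n)) (*S-identityʳ sumX n) ⟩
    sumFam (λ i → expS *S X i) n + sumX n
  ≡⟨ cong₂ _+_ (sumTo-suc-head n (λ i → (expS *S X i) n)) (sumTo-suc-last-zero n (X-vanishesBelow n n ℕ.≤-refl)) ⟩
    ((expS *S X 0) n + sumTo n (λ i → eX (suc i))) + sumTo n (λ i → X i n)
  ≡⟨ solve 3 (λ a b c → (a :+ b) :+ c := a :+ (c :+ b)) refl ((expS *S X 0) n) (sumTo n (λ i → eX (suc i))) (sumTo n (λ i → X i n)) ⟩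
    (expS *S X 0) n + (sumTo n (λ i → X i n) + sumTo n (λ i → eX (suc i)))
  ≡⟨ cong (_+_ ((expS *S X 0) n)) (sym (sumTo-+ n (λ i → X i n) (λ i → eX (suc i)))) ⟩
    (expS *S X 0) n + sumTo n (λ i → X i n + eX (suc i))
  ≡⟨ cong₂ _+_ (expS*X₀ n) (sumTo-cong n (λ i → X+expS*X i n)) ⟩
    tS n + sumTo n (λ i → (+ 1 / suc i) * zPow (suc i) n)
  ≡⟨ cong (_+_ (tS n)) (trans (sym (sumTo-suc-last-zero n
                                (scaleS-vanishesBelow (+ 1 / suc n) (zPow-vanishesBelow (suc n)) n ℕ.≤-refl)))
                              (sumFam-zPow/ n)) ⟩
    tS n + tS n
  ≡⟨ solve 1 (λ x → x :+ x := (con 1ℚ :+ con 1ℚ) :* x) refl (tS n) ⟩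
    (+ 2 / 1) * tS n
  ∎
  where
  open ≡-Reasoning
  eX : ℕ → ℚ
  eX i = (expS *S X i) n

genocchi-egf : genocchi ≗ egfCoeff sumX
genocchi-egf n = cong (fromℕ (n !) *_) (divUnit-unique sumX refl sumX*[expS+oneS] n)

sumWeightedX : Series
sumWeightedX = sumFam (λ i → scaleS (fromℕ (suc i)) (X i))

∂-sumX : ∂ sumX ≗ oneS -S sumWeightedX
∂-sumX n = begin
    ∂ sumX n
  ≡⟨ ∂-sumFam X n ⟩
    sumTo (suc (suc n)) (λ i → ∂ (X i) n)
  ≡⟨ sumTo-cong (suc (suc n)) (λ i → ∂-X i n) ⟩
    sumTo (suc (suc n)) (λ i → E i n - fromℕ (suc i) * X i n)
  ≡⟨ sumTo-- (suc (suc n)) (λ i → E i n) (λ i → fromℕ (suc i) * X i n) ⟩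
    sumTo (suc (suc n)) (λ i → E i n) - sumTo (suc (suc n)) (λ i → fromℕ (suc i) * X i n)
  ≡⟨ cong₂ _-_ (sumTo-suc-last-zero (suc n) (E-vanishesBelow (suc n) n ℕ.≤-refl))
               (sumTo-suc-last-zero (suc n)
                 (scaleS-vanishesBelow (fromℕ (suc (suc n))) (X-vanishesBelow′ (suc n)) n ℕ.≤-refl)) ⟩
    sumFam E n - sumWeightedX n
  ≡⟨ cong (_- sumWeightedX n) (sumFam-E n) ⟩
    oneS n - sumWeightedX n
  ∎
  where open ≡-Reasoning

genocchi-sumWeightedX : ∀ n →
  - genocchi (suc (suc n)) ≡ sumTo (suc (suc n)) (λ i → fromℕ (suc i) * egfCoeff (X i) (suc n))
genocchi-sumWeightedX n = begin
    - genocchi (suc (suc n))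
  ≡⟨ cong -_ (trans (genocchi-egf (suc (suc n))) (egfCoeff-suc sumX (suc n))) ⟩
    - egfCoeff (∂ sumX) (suc n)
  ≡⟨ cong (λ x → - (fromℕ (suc n !) * x)) (∂-sumX (suc n)) ⟩
    - egfCoeff (oneS -S sumWeightedX) (suc n)
  ≡⟨ solve 2 (λ f w → :- (f :* (con 0ℚ :- w)) := f :* w) refl (fromℕ (suc n !)) (sumWeightedX (suc n)) ⟩
    egfCoeff sumWeightedX (suc n)
  ≡⟨ egfCoeff-sumFam (λ i → scaleS-vanishesBelow (fromℕ (suc i)) (X-vanishesBelow′ i)) {n = suc n} ℕ.≤-refl ⟩
    sumTo (suc (suc n)) (λ i → egfCoeff (scaleS (fromℕ (suc i)) (X i)) (suc n))
  ≡⟨ sumTo-cong (suc (suc n)) (λ i → egfCoeff-scaleS (fromℕ (suc i)) (X i) (suc n)) ⟩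
    sumTo (suc (suc n)) (λ i → fromℕ (suc i) * egfCoeff (X i) (suc n))
  ∎
  where open ≡-Reasoning

-- The alternating sum

minusOne^ : ℕ → ℚ
minusOne^ l = (ℤ.- (+ 1)) ℤ.^ l / 1

unfold-linear-recurrence : ∀ k (e x : ℕ → ℚ) → x 0 ≡ 0ℚ → (∀ m → x (suc m) ≡ e m - fromℕ k * x m) →
  ∀ n → fromℕ k * x (suc n) ≡ sumTo (suc n) (λ l → minusOne^ l * (fromℕ (k ^ suc l) * e (n ∸ l)))
unfold-linear-recurrence k e x x₀≡0 rec zero = begin
    fromℕ k * x 1
  ≡⟨ cong (fromℕ k *_) (trans (rec 0) (cong (λ y → e 0 - fromℕ k * y) x₀≡0)) ⟩
    fromℕ k * (e 0 - fromℕ k * 0ℚ)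
  ≡⟨ solve 2 (λ k e → k :* (e :- k :* con 0ℚ) := con 0ℚ :+ con 1ℚ :* (k :* e)) refl (fromℕ k) (e 0) ⟩
    0ℚ + 1ℚ * (fromℕ k * e 0)
  ≡⟨ cong (λ m → 0ℚ + 1ℚ * (fromℕ m * e 0)) (sym (ℕ.*-identityʳ k)) ⟩
    0ℚ + minusOne^ 0 * (fromℕ (k ^ 1) * e 0)
  ∎
  where open ≡-Reasoning
unfold-linear-recurrence k e x x₀≡0 rec (suc n) = begin
    fromℕ k * x (suc (suc n))
  ≡⟨ cong (fromℕ k *_) (rec (suc n)) ⟩
    fromℕ k * (e (suc n) - fromℕ k * x (suc n))
  ≡⟨ cong (λ y → fromℕ k * (e (suc n) - y)) (unfold-linear-recurrence k e x x₀≡0 rec n) ⟩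
    fromℕ k * (e (suc n) - sumTo (suc n) term)
  ≡⟨ solve 3 (λ k e s → k :* (e :- s) := con 1ℚ :* (k :* e) :+ (:- k) :* s) refl (fromℕ k) (e (suc n)) (sumTo (suc n) term) ⟩
    1ℚ * (fromℕ k * e (suc n)) + (- fromℕ k) * sumTo (suc n) term
  ≡⟨ cong₂ _+_ (cong (λ m → 1ℚ * (fromℕ m * e (suc n))) (sym (ℕ.*-identityʳ k)))
               (*-distribˡ-sumTo (suc n) (- fromℕ k) term) ⟩
    minusOne^ 0 * (fromℕ (k ^ 1) * e (suc n)) + sumTo (suc n) (λ l → (- fromℕ k) * term l)
  ≡⟨ cong (_+_ (minusOne^ 0 * (fromℕ (k ^ 1) * e (suc n)))) (sumTo-cong (suc n) next-term) ⟩
    minusOne^ 0 * (fromℕ (k ^ 1) * e (suc n))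
      + sumTo (suc n) (λ l → minusOne^ (suc l) * (fromℕ (k ^ suc (suc l)) * e (n ∸ l)))
  ≡⟨ sym (sumTo-suc-head (suc n) (λ l → minusOne^ l * (fromℕ (k ^ suc l) * e (suc n ∸ l)))) ⟩
    sumTo (suc (suc n)) (λ l → minusOne^ l * (fromℕ (k ^ suc l) * e (suc n ∸ l)))
  ∎
  where
  open ≡-Reasoning
  term : ℕ → ℚ
  term l = minusOne^ l * (fromℕ (k ^ suc l) * e (n ∸ l))
  next-term : ∀ l → (- fromℕ k) * term l ≡ minusOne^ (suc l) * (fromℕ (k ^ suc (suc l)) * e (n ∸ l))
  next-term l = trans
    (solve 4 (λ k s w x → (:- k) :* (s :* (w :* x)) := (:- s) :* ((k :* w) :* x)) refl
           (fromℕ k) (minusOne^ l) (fromℕ (k ^ suc l)) (e (n ∸ l)))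
    (sym (cong₂ (λ s w → s * (w * e (n ∸ l))) ([-1]^[1+l]/d l 1) (fromℕ-* k (k ^ suc l))))

egfCoeff-X-alternating : ∀ i n → fromℕ (suc i) * egfCoeff (X i) (suc n) ≡
  sumTo (suc n) (λ l → minusOne^ l * (fromℕ (suc i ^ suc l) * egfCoeff (E i) (n ∸ l)))
egfCoeff-X-alternating i =
  unfold-linear-recurrence (suc i) (egfCoeff (E i)) (egfCoeff (X i))
    (*-zeroʳ (fromℕ (0 !))) (egfCoeff-linearODE (fromℕ (suc i)) (∂-X i))

theorem4p2 : (n : ℕ) →
    sumTo (suc n) (λ l → ((ℤ.- (+ 1)) ℤ.^ l / 1) * polyBernoulliC -[1+ l ] (n ∸ l))
      ≡ - genocchi (suc (suc n))
theorem4p2 n = begin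
    sumTo (suc n) (λ l → minusOne^ l * polyBernoulliC -[1+ l ] (n ∸ l))
  ≡⟨ sumTo-cong (suc n) (λ l → cong (minusOne^ l *_)
                                   (polyBernoulliC-neg-expand l (s≤s (ℕ.m≤n⇒m≤1+n (ℕ.m∸n≤m n l))))) ⟩
    sumTo (suc n) (λ l → minusOne^ l * sumTo (suc (suc n)) (term l))
  ≡⟨ sumTo-cong (suc n) (λ l → *-distribˡ-sumTo (suc (suc n)) (minusOne^ l) (term l)) ⟩
    sumTo (suc n) (λ l → sumTo (suc (suc n)) (λ i → minusOne^ l * term l i))
  ≡⟨ sumTo-swap (suc n) (suc (suc n)) (λ l i → minusOne^ l * term l i) ⟩
    sumTo (suc (suc n)) (λ i → sumTo (suc n) (λ l → minusOne^ l * term l i))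
  ≡⟨ sumTo-cong (suc (suc n)) (λ i → sym (egfCoeff-X-alternating i n)) ⟩
    sumTo (suc (suc n)) (λ i → fromℕ (suc i) * egfCoeff (X i) (suc n))
  ≡⟨ sym (genocchi-sumWeightedX n) ⟩
    - genocchi (suc (suc n))
  ∎
  where
  open ≡-Reasoning
  term : ℕ → ℕ → ℚ
  term l i = fromℕ (suc i ^ suc l) * egfCoeff (E i) (n ∸ l)
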